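{- Let $r,s,k$ be integers with $1\le k\le\min\{r,s\}$, and let $F$ be a field with $|F|\ge k+2$. Then there exist $A\in F^{r\times r}$ and $B\in F^{s\times s}$ such that the linear code $C(A,B)$ has dimension $k$ and minimum distance $d=\lfloor r/k\rfloor s$.
   Context: $C(A,B):=\{X\in F^{r\times s}\mid AX=XB\}$, viewed as a linear code in $F^{rs}$ (coordinates are the matrix entries). The minimum (Hamming) distance of a nonzero subspace is the minimum number of nonzero entries of a nonzero element. -}

module Defs where

open import Level using (Level; _⊔_) renaming (suc to lsuc)
open import Data.Nat using (ℕ; zero; suc) renaming (_+_ to _+ℕ_)
open import Data.Fin using (Fin; zero; suc)
open import Data.Bool using (Bool; true; false; if_then_else_)
open import Data.Product using (Σ; ∃; _×_; _,_)
open import Relation.Nullary using (¬_)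
open import Relation.Binary.PropositionalEquality using (_≡_)
open import Function.Bundles using (_⇔_)
open import Algebra.Bundles using (CommutativeRing)

record Field (c ℓ : Level) : Set (lsuc (c ⊔ ℓ)) where
  field
    commutativeRing : CommutativeRing c ℓ
  open CommutativeRing commutativeRing public
  field
    0≉1     : ¬ (0# ≈ 1#)
    inverse : ∀ x → ¬ (x ≈ 0#) → ∃ λ y → x * y ≈ 1#

-- |F| ≥ n : there are n pairwise distinct elements of F.
HasAtLeast : ∀ {c ℓ} → Field c ℓ → ℕ → Set (c ⊔ ℓ)
HasAtLeast F n = Σ (Fin n → Carrier) λ f → ∀ a b → f a ≈ f b → a ≡ b
  where open Field F

countTrue : ∀ {n} → (Fin n → Bool) → ℕ
countTrue {zero}  v = 0
countTrue {suc n} v = (if v zero then 1 else 0) +ℕ countTrue (λ i → v (suc i))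

countTrue₂ : ∀ {r s} → (Fin r → Fin s → Bool) → ℕ
countTrue₂ {zero}  S = 0
countTrue₂ {suc r} S = countTrue (S zero) +ℕ countTrue₂ (λ i → S (suc i))

module FieldMatrices {c ℓ} (F : Field c ℓ) where
  open Field F using (Carrier; _≈_; _+_; _*_; 0#; 1#)

  Matrix : ℕ → ℕ → Set c
  Matrix m n = Fin m → Fin n → Carrier

  ∑ : ∀ {n} → (Fin n → Carrier) → Carrier
  ∑ {zero}  f = 0#
  ∑ {suc n} f = f zero + ∑ (λ i → f (suc i))

  _⊗_ : ∀ {m n p} → Matrix m n → Matrix n p → Matrix m p
  (A ⊗ B) i j = ∑ λ l → A i l * B l j

  _≈ₘ_ : ∀ {m n} → Matrix m n → Matrix m n → Set ℓ
  X ≈ₘ Y = ∀ i j → X i j ≈ Y i j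

  0ₘ : ∀ {m n} → Matrix m n
  0ₘ i j = 0#

  InC : ∀ {r s} → Matrix r r → Matrix s s → Matrix r s → Set ℓ
  InC A B X = (A ⊗ X) ≈ₘ (X ⊗ B)

  lincomb : ∀ {k r s} → (Fin k → Carrier) → (Fin k → Matrix r s) → Matrix r s
  lincomb cs Xs i j = ∑ λ t → cs t * Xs t i j

  HasDimension : ∀ {r s} → Matrix r r → Matrix s s → ℕ → Set (c ⊔ ℓ)
  HasDimension {r} {s} A B k =
    Σ (Fin k → Matrix r s) λ b →
      (∀ t → InC A B (b t)) ×
      (∀ (cs : Fin k → Carrier) → lincomb cs b ≈ₘ 0ₘ → ∀ t → cs t ≈ 0#) ×
      (∀ X → InC A B X → ∃ λ (cs : Fin k → Carrier) → X ≈ₘ lincomb cs b)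

  HasWeight : ∀ {r s} → Matrix r s → ℕ → Set ℓ
  HasWeight {r} {s} X w =
    Σ (Fin r → Fin s → Bool) λ S →
      (∀ i j → (S i j ≡ true) ⇔ (¬ (X i j ≈ 0#))) × countTrue₂ S ≡ w

  HasMinDistance : ∀ {r s} → Matrix r r → Matrix s s → ℕ → Set (c ⊔ ℓ)
  HasMinDistance {r} {s} A B d =
    (∃ λ (X : Matrix r s) → InC A B X × ¬ (X ≈ₘ 0ₘ) × HasWeight X d) ×
    (∀ (X : Matrix r s) → InC A B X → ¬ (X ≈ₘ 0ₘ) → ∀ w → HasWeight X w → d Data.Nat.≤ w)

module Submission where

-- Split the rows Fin r into k blocks, each of size at least q = ⌊r/k⌋ with
-- one block of size exactly q, and fix a representative row in each block;
-- rep p is the representative of the block of p.  Choose scalars α, β with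
-- 0, α, β pairwise distinct (possible as |F| ≥ 3), and put
--   A = α (I − P_rep),   (P_rep X) p j = X (rep p) j,
--   B = β (I − S),        (X S) p j = X p (prev j),  prev 0 = 0, prev (j+1) = j.
-- Entrywise AX = XB reads α (X p j − X (rep p) j) = β (X p j − X p (prev j)).
-- Since α, β and β − α are nonzero, this forces every row of a block to be
-- the constant row X (rep p) 0, and conversely every such X is a codeword.
-- Hence C(A,B) consists of the matrices that are constant on each block:
-- the block indicators form a basis (dimension k), a nonzero codeword is
-- nonzero on at least one whole block (weight ≥ q·s), and the indicator of
-- the smallest block has weight exactly q·s.

open import Defs
open import Level using (Level)
open import Data.Nat using (ℕ; _≤_; _+_; _*_; _/_; >-nonZero)
open import Data.Product using (∃; ∃₂; _×_)
open import Data.Nat using (zero; suc; z≤n; s≤s; _≤?_; _%_)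
import Data.Nat.Properties as ℕ
open import Data.Nat.DivMod using (m≡m%n+[m/n]*n; m%n<n; m≥n⇒m/n>0)
open import Data.Fin using (Fin; zero; suc; _↑ˡ_; _↑ʳ_; splitAt; inject₁; inject≤; fromℕ; fromℕ<; _≟_)
open import Data.Fin.Properties using (splitAt-↑ˡ; splitAt-↑ʳ; fromℕ≢inject₁; fromℕ<-injective)
open import Data.Fin.Induction using (<-weakInduction)
open import Data.Bool using (Bool; true; false; if_then_else_)
open import Data.Sum using ([_,_])
open import Data.Product using (Σ; _,_; proj₁; proj₂)
open import Data.Empty using (⊥-elim)
open import Function using (id)
open import Function.Bundles using (_⇔_; mk⇔; Equivalence)
open import Relation.Nullary using (¬_; yes; no; does)
open import Relation.Nullary.Decidable using (dec-false; decidable-stable)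
open import Relation.Binary.PropositionalEquality as ≡ using (_≡_; cong; cong₂; subst)

countTrue-cong : ∀ {n} {u v : Fin n → Bool} → (∀ i → u i ≡ v i) → countTrue u ≡ countTrue v
countTrue-cong {zero}  e = ≡.refl
countTrue-cong {suc n} e = cong₂ _+_ (cong (λ b → if b then 1 else 0) (e zero)) (countTrue-cong (λ i → e (suc i)))

countTrue-none : ∀ {n} (v : Fin n → Bool) → (∀ i → v i ≡ false) → countTrue v ≡ 0
countTrue-none {zero}  v e = ≡.refl
countTrue-none {suc n} v e rewrite e zero = countTrue-none (λ i → v (suc i)) (λ i → e (suc i))

countTrue-all : ∀ n → countTrue {n} (λ _ → true) ≡ n
countTrue-all zero    = ≡.refl
countTrue-all (suc n) = cong suc (countTrue-all n)

countTrue-const : ∀ n b → countTrue {n} (λ _ → b) ≡ (if b then 1 else 0) * n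
countTrue-const n true  = ≡.trans (countTrue-all n) (≡.sym (ℕ.+-identityʳ n))
countTrue-const n false = countTrue-none {n} (λ _ → false) (λ _ → ≡.refl)

countTrue-split : ∀ m n (v : Fin (m + n) → Bool) →
  countTrue v ≡ countTrue (λ i → v (i ↑ˡ n)) + countTrue (λ i → v (m ↑ʳ i))
countTrue-split zero    n v = ≡.refl
countTrue-split (suc m) n v =
  ≡.trans (cong ((if v zero then 1 else 0) +_) (countTrue-split m n (λ i → v (suc i))))
          (≡.sym (ℕ.+-assoc (if v zero then 1 else 0) _ _))

countTrue-single : ∀ {n} (t : Fin n) → countTrue (λ i → does (i ≟ t)) ≡ 1
countTrue-single {suc n} zero    = cong suc (countTrue-none {n} (λ i → does (suc i ≟ zero)) (λ i → ≡.refl))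
countTrue-single {suc n} (suc t) = countTrue-single t

countTrue-mono : ∀ {n} (u v : Fin n → Bool) → (∀ i → u i ≡ true → v i ≡ true) → countTrue u ≤ countTrue v
countTrue-mono {zero}  u v h = z≤n
countTrue-mono {suc n} u v h with u zero | v zero | h zero
... | true  | true  | _ = s≤s (countTrue-mono _ _ (λ i → h (suc i)))
... | true  | false | h₀ with () ← h₀ ≡.refl
... | false | true  | _ = ℕ.≤-trans (countTrue-mono _ _ (λ i → h (suc i))) (ℕ.n≤1+n _)
... | false | false | _ = countTrue-mono _ _ (λ i → h (suc i))

countTrue-witness : ∀ {n} (v : Fin n → Bool) → 1 ≤ countTrue v → ∃ λ i → v i ≡ true
countTrue-witness {suc n} v h with v zero in eq
... | true  = zero , eq
... | false = let (i , e) = countTrue-witness (λ i → v (suc i)) h in suc i , e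

countTrue₂-mono : ∀ {r s} (S T : Fin r → Fin s → Bool) →
  (∀ p j → S p j ≡ true → T p j ≡ true) → countTrue₂ S ≤ countTrue₂ T
countTrue₂-mono {zero}  S T h = z≤n
countTrue₂-mono {suc r} S T h =
  ℕ.+-mono-≤ (countTrue-mono (S zero) (T zero) (h zero))
           (countTrue₂-mono (λ p → S (suc p)) (λ p → T (suc p)) (λ p → h (suc p)))

countTrue₂-rows : ∀ {r s} (R : Fin r → Bool) → countTrue₂ {r} {s} (λ p j → R p) ≡ countTrue R * s
countTrue₂-rows {zero}      R = ≡.refl
countTrue₂-rows {suc r} {s} R =
  ≡.trans (cong₂ _+_ (countTrue-const s (R zero)) (countTrue₂-rows (λ p → R (suc p))))
          (≡.sym (ℕ.*-distribʳ-+ s (if R zero then 1 else 0) (countTrue (λ p → R (suc p)))))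

does-sound : ∀ {n} (a b : Fin n) → does (a ≟ b) ≡ true → a ≡ b
does-sound a b e with a ≟ b
... | yes a≡b = a≡b

module Blocks (k : ℕ) where

  blockSize : ∀ {m} → (Fin m → Fin (suc k)) → Fin (suc k) → ℕ
  blockSize block t = countTrue (λ p → does (block p ≟ t))

  record Partition (m q : ℕ) : Set where
    field
      block         : Fin m → Fin (suc k)
      large         : ∀ t → q ≤ blockSize block t
      smallest      : Fin (suc k)
      smallest-size : blockSize block smallest ≡ q

  -- Fewer than suc k elements: put them in distinct blocks, leaving the last empty.
  initial : ∀ {m} → m ≤ k → Partition m 0
  initial {m} m≤k = record
    { block = block ; large = λ _ → z≤n ; smallest = fromℕ k
    ; smallest-size = countTrue-none _ (λ p → dec-false (block p ≟ fromℕ k) (λ e → fromℕ≢inject₁ (≡.sym e))) }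
    where
    block : Fin m → Fin (suc k)
    block p = inject₁ (inject≤ p m≤k)

  -- Prepending one element to every block raises every block size by one.
  extend : ∀ {m q} → Partition m q → Partition (suc k + m) (suc q)
  extend {m} {q} P = record
    { block = block ; large = λ t → subst (suc q ≤_) (≡.sym (grows t)) (s≤s (large t))
    ; smallest = smallest ; smallest-size = ≡.trans (grows smallest) (cong suc smallest-size) }
    where
    open Partition P renaming (block to old)
    block : Fin (suc k + m) → Fin (suc k)
    block p = [ id , old ] (splitAt (suc k) p)
    grows : ∀ t → blockSize block t ≡ suc (blockSize old t)
    grows t = begin
      blockSize block t
        ≡⟨ countTrue-split (suc k) m (λ p → does (block p ≟ t)) ⟩
      countTrue (λ i → does (block (i ↑ˡ m) ≟ t)) + countTrue (λ i → does (block (suc k ↑ʳ i) ≟ t))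
        ≡⟨ cong₂ _+_ (countTrue-cong (λ i → cong (λ z → does ([ id , old ] z ≟ t)) (splitAt-↑ˡ (suc k) i m)))
                     (countTrue-cong (λ i → cong (λ z → does ([ id , old ] z ≟ t)) (splitAt-↑ʳ (suc k) m i))) ⟩
      countTrue (λ i → does (i ≟ t)) + blockSize old t
        ≡⟨ cong (_+ blockSize old t) (countTrue-single t) ⟩
      suc (blockSize old t) ∎
      where open ≡.≡-Reasoning

  -- q rounds of suc k elements, one per block, followed by rem ≤ k leftovers.
  partitionOf : ∀ q rem → rem ≤ k → Partition (q * suc k + rem) q
  partitionOf zero    rem rem≤k = initial rem≤k
  partitionOf (suc q) rem rem≤k =
    subst (λ m → Partition m (suc q)) (≡.sym (ℕ.+-assoc (suc k) (q * suc k) rem))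
          (extend (partitionOf q rem rem≤k))

  balanced : ∀ r → Partition r (r / suc k)
  balanced r = subst (λ m → Partition m (r / suc k)) (≡.sym r≡)
                     (partitionOf (r / suc k) (r % suc k) (ℕ.≤-pred (m%n<n r (suc k))))
    where
    r≡ : r ≡ r / suc k * suc k + r % suc k
    r≡ = ≡.trans (m≡m%n+[m/n]*n r (suc k)) (ℕ.+-comm (r % suc k) _)

  representatives : ∀ {m q} (P : Partition m q) → 1 ≤ q →
    Σ (Fin (suc k) → Fin m) λ rep → ∀ t → Partition.block P (rep t) ≡ t
  representatives P 1≤q = (λ t → proj₁ (witness t)) , λ t → does-sound _ _ (proj₂ (witness t))
    where
    open Partition P
    witness : ∀ t → ∃ λ p → does (block p ≟ t) ≡ true
    witness t = countTrue-witness _ (ℕ.≤-trans 1≤q (large t))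

¬¬-∀-Fin : ∀ {a} {n} {Q : Fin n → Set a} → (∀ t → ¬ ¬ Q t) → ¬ ¬ (∀ t → Q t)
¬¬-∀-Fin {n = zero}      h k = k (λ ())
¬¬-∀-Fin {n = suc n} {Q} h k = h zero (λ q₀ → ¬¬-∀-Fin (λ t → h (suc t))
  (λ rest → k (λ { zero → q₀ ; (suc t) → rest t })))

prev : ∀ {n} → Fin (suc n) → Fin (suc n)
prev zero    = zero
prev (suc j) = inject₁ j

module Construction {c ℓ : Level} (F : Field c ℓ) where
  open Field F hiding (zero) renaming (_+_ to _⊕_; _*_ to _·_)
  open FieldMatrices F
  open import Algebra.Properties.Ring ring using (-‿distribˡ-*; x[y-z]≈xy-xz; [y-z]x≈yx-zx)
  open import Algebra.Properties.AbelianGroup +-abelianGroup using (x∙y⁻¹≈ε⇒x≈y; x≈y⇒x∙y⁻¹≈ε; ∙-cancelʳ)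
  open import Algebra.Properties.Semiring.Sum semiring using (sum; sum-cong-≋; sum-replicate-zero; ∑-distrib-+; *-distribˡ-sum)
  open import Relation.Binary.Reasoning.Setoid setoid

  nonzero-cancel : ∀ {x y} → ¬ (x ≈ 0#) → x · y ≈ 0# → y ≈ 0#
  nonzero-cancel {x} {y} x≉0 xy≈0 with inverse x x≉0
  ... | (x⁻¹ , xx⁻¹≈1) = begin
    y              ≈⟨ *-identityˡ y ⟨
    1# · y         ≈⟨ *-congʳ (trans (sym xx⁻¹≈1) (*-comm x x⁻¹)) ⟩
    (x⁻¹ · x) · y  ≈⟨ *-assoc x⁻¹ x y ⟩
    x⁻¹ · (x · y)  ≈⟨ *-congˡ xy≈0 ⟩
    x⁻¹ · 0#       ≈⟨ zeroʳ x⁻¹ ⟩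
    0#             ∎

  distinct-scalars : ∀ {x y u} → ¬ (x ≈ y) → x · u ≈ y · u → u ≈ 0#
  distinct-scalars {x} {y} {u} x≉y xu≈yu =
    nonzero-cancel (λ e → x≉y (x∙y⁻¹≈ε⇒x≈y x y e))
                   (trans ([y-z]x≈yx-zx u x y) (x≈y⇒x∙y⁻¹≈ε xu≈yu))

  scaled-difference : ∀ a u v → a · u ⊕ (- a) · v ≈ a · (u - v)
  scaled-difference a u v =
    trans (+-congˡ (sym (-‿distribˡ-* a v))) (sym (x[y-z]≈xy-xz a u v))

  δ : ∀ {n} → Fin n → Fin n → Carrier
  δ a l = if does (a ≟ l) then 1# else 0#

  δ-diag : ∀ {n} (a : Fin n) → δ a a ≈ 1#
  δ-diag a with a ≟ a
  ... | yes _  = refl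
  ... | no a≢a = ⊥-elim (a≢a ≡.refl)

  δ-support : ∀ {n} (a b : Fin n) → (does (a ≟ b) ≡ true) ⇔ (¬ (δ a b ≈ 0#))
  δ-support a b with a ≟ b
  ... | yes _ = mk⇔ (λ _ 1≈0 → 0≉1 (sym 1≈0)) (λ _ → ≡.refl)
  ... | no _  = mk⇔ (λ ()) (λ 0≉0 → ⊥-elim (0≉0 refl))

  ∑≡sum : ∀ {n} (f : Fin n → Carrier) → ∑ f ≡ sum f
  ∑≡sum {zero}  f = ≡.refl
  ∑≡sum {suc n} f = cong (f zero ⊕_) (∑≡sum (λ i → f (suc i)))

  sift : ∀ {n} (a : Fin n) (g : Fin n → Carrier) → sum (λ l → δ a l · g l) ≈ g a
  sift {suc n} zero g = begin
    1# · g zero ⊕ sum (λ l → 0# · g (suc l)) ≈⟨ +-cong (*-identityˡ _) (sum-cong-≋ (λ l → zeroˡ (g (suc l)))) ⟩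
    g zero ⊕ sum {n} (λ _ → 0#)               ≈⟨ +-congˡ (sum-replicate-zero n) ⟩
    g zero ⊕ 0#                               ≈⟨ +-identityʳ _ ⟩
    g zero                                    ∎
  sift {suc n} (suc a) g = begin
    0# · g zero ⊕ sum (λ l → δ a l · g (suc l)) ≈⟨ +-cong (zeroˡ _) (sift a (λ l → g (suc l))) ⟩
    0# ⊕ g (suc a)                               ≈⟨ +-identityˡ _ ⟩
    g (suc a)                                    ∎

  sift′ : ∀ {n} (a : Fin n) (g : Fin n → Carrier) → ∑ (λ l → g l · δ a l) ≈ g a
  sift′ {n} a g = trans (reflexive (∑≡sum {n} _)) (trans (sum-cong-≋ (λ l → *-comm (g l) (δ a l))) (sift a g))

  sift₂ : ∀ {n} (x y : Carrier) (a b : Fin n) (g : Fin n → Carrier) →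
    ∑ (λ l → (x · δ a l ⊕ y · δ b l) · g l) ≈ x · g a ⊕ y · g b
  sift₂ {n} x y a b g = begin
    ∑ (λ l → (x · δ a l ⊕ y · δ b l) · g l)
      ≡⟨ ∑≡sum {n} _ ⟩
    sum (λ l → (x · δ a l ⊕ y · δ b l) · g l)
      ≈⟨ sum-cong-≋ (λ l → trans (distribʳ (g l) _ _) (+-cong (*-assoc x _ _) (*-assoc y _ _))) ⟩
    sum (λ l → x · (δ a l · g l) ⊕ y · (δ b l · g l))
      ≈⟨ ∑-distrib-+ (λ l → x · (δ a l · g l)) (λ l → y · (δ b l · g l)) ⟩
    sum (λ l → x · (δ a l · g l)) ⊕ sum (λ l → y · (δ b l · g l))
      ≈⟨ +-cong (*-distribˡ-sum x (λ l → δ a l · g l)) (*-distribˡ-sum y (λ l → δ b l · g l)) ⟨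
    x · sum (λ l → δ a l · g l) ⊕ y · sum (λ l → δ b l · g l)
      ≈⟨ +-cong (*-congˡ (sift a g)) (*-congˡ (sift b g)) ⟩
    x · g a ⊕ y · g b ∎

  sift₂′ : ∀ {n} (x y : Carrier) (a b : Fin n) (g : Fin n → Carrier) →
    ∑ (λ l → g l · (x · δ a l ⊕ y · δ b l)) ≈ x · g a ⊕ y · g b
  sift₂′ {n} x y a b g = begin
    ∑ (λ l → g l · (x · δ a l ⊕ y · δ b l)) ≡⟨ ∑≡sum {n} _ ⟩
    sum (λ l → g l · (x · δ a l ⊕ y · δ b l)) ≈⟨ sum-cong-≋ (λ l → *-comm (g l) _) ⟩
    sum (λ l → (x · δ a l ⊕ y · δ b l) · g l) ≡⟨ ∑≡sum {n} _ ⟨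
    ∑ (λ l → (x · δ a l ⊕ y · δ b l) · g l)   ≈⟨ sift₂ x y a b g ⟩
    x · g a ⊕ y · g b ∎

  module Code {r n : ℕ} (α β : Carrier) (α≉0 : ¬ (α ≈ 0#)) (β≉0 : ¬ (β ≈ 0#)) (α≉β : ¬ (α ≈ β))
              (rep : Fin r → Fin r) (rep-idem : ∀ p → rep (rep p) ≡ rep p) where

    -- A = α (I − P), where row p of P is the unit row of rep p.
    A : Matrix r r
    A p l = α · δ p l ⊕ (- α) · δ (rep p) l

    -- B = β (I − S), where column j of S is the unit column of prev j.
    B : Matrix (suc n) (suc n)
    B l j = β · δ j l ⊕ (- β) · δ (prev j) l

    A⊗ : ∀ (X : Matrix r (suc n)) p j → (A ⊗ X) p j ≈ α · (X p j - X (rep p) j)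
    A⊗ X p j = trans (sift₂ α (- α) p (rep p) (λ l → X l j)) (scaled-difference α _ _)

    ⊗B : ∀ (X : Matrix r (suc n)) p j → (X ⊗ B) p j ≈ β · (X p j - X p (prev j))
    ⊗B X p j = trans (sift₂′ β (- β) j (prev j) (X p)) (scaled-difference β _ _)

    entrywise : ∀ (X : Matrix r (suc n)) → InC A B X → ∀ p j → α · (X p j - X (rep p) j) ≈ β · (X p j - X p (prev j))
    entrywise X X∈C p j = trans (sym (A⊗ X p j)) (trans (X∈C p j) (⊗B X p j))

    -- In column 0 the right-hand side vanishes, so α u ≈ 0 forces u ≈ 0.
    first-column : ∀ {u v} → α · u ≈ β · (v - v) → u ≈ 0#
    first-column e = nonzero-cancel α≉0 (trans e (trans (*-congˡ (-‿inverseʳ _)) (zeroʳ β)))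

    constant-row : (g : Fin (suc n) → Carrier) → (∀ j → g j ≈ g (prev j)) → ∀ j → g j ≈ g zero
    constant-row g step = <-weakInduction (λ j → g j ≈ g zero) refl (λ j hyp → trans (step (suc j)) hyp)

    representative-row : ∀ (X : Matrix r (suc n)) → InC A B X → ∀ p j → X (rep p) j ≈ X (rep p) zero
    representative-row X X∈C p = constant-row (X (rep p)) (λ j →
      x∙y⁻¹≈ε⇒x≈y _ _ (nonzero-cancel β≉0 (trans (sym (entrywise X X∈C (rep p) j))
        (trans (*-congˡ (subst (λ q → X (rep p) j - X q j ≈ 0#) (≡.sym (rep-idem p)) (-‿inverseʳ _)))
               (zeroʳ α)))))

    codeword-shape : ∀ (X : Matrix r (suc n)) → InC A B X → ∀ p j → X p j ≈ X (rep p) zero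
    codeword-shape X X∈C p = <-weakInduction (λ j → X p j ≈ v) first next
      where
      v : Carrier
      v = X (rep p) zero
      first : X p zero ≈ v
      first = x∙y⁻¹≈ε⇒x≈y _ _ (first-column (entrywise X X∈C p zero))
      next : ∀ j → X p (inject₁ j) ≈ v → X p (suc j) ≈ v
      next j hyp = x∙y⁻¹≈ε⇒x≈y _ _ (distinct-scalars α≉β (begin
        α · (X p (suc j) - v)              ≈⟨ *-congˡ (+-congˡ (-‿cong (representative-row X X∈C p (suc j)))) ⟨
        α · (X p (suc j) - X (rep p) (suc j)) ≈⟨ entrywise X X∈C p (suc j) ⟩
        β · (X p (suc j) - X p (inject₁ j)) ≈⟨ *-congˡ (+-congˡ (-‿cong hyp)) ⟩
        β · (X p (suc j) - v)              ∎))

    codeword-intro : ∀ (X : Matrix r (suc n)) → (∀ p j → X p j ≈ X (rep p) zero) → InC A B X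
    codeword-intro X shape p j = begin
      (A ⊗ X) p j                   ≈⟨ A⊗ X p j ⟩
      α · (X p j - X (rep p) j)     ≈⟨ *-congˡ (x≈y⇒x∙y⁻¹≈ε same-as-rep) ⟩
      α · 0#                        ≈⟨ zeroʳ α ⟩
      0#                            ≈⟨ zeroʳ β ⟨
      β · 0#                        ≈⟨ *-congˡ (x≈y⇒x∙y⁻¹≈ε (trans (shape p j) (sym (shape p (prev j))))) ⟨
      β · (X p j - X p (prev j))    ≈⟨ ⊗B X p j ⟨
      (X ⊗ B) p j                   ∎
      where
      same-as-rep : X p j ≈ X (rep p) j
      same-as-rep = trans (shape p j) (sym (subst (λ q → X (rep p) j ≈ X q zero) (rep-idem p) (shape (rep p) j)))

  scalars : ∀ {m} → HasAtLeast F m → 3 ≤ m →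
    ∃₂ λ α β → ¬ (α ≈ 0#) × ¬ (β ≈ 0#) × ¬ (α ≈ β)
  scalars {m} (a , a-injective) 3≤m = a i₁ - a i₀ , a i₂ - a i₀ , α≉0 , β≉0 , α≉β
    where
    i₀ i₁ i₂ : Fin m
    i₀ = fromℕ< (ℕ.≤-trans (s≤s z≤n) 3≤m)
    i₁ = fromℕ< (ℕ.≤-trans (s≤s (s≤s z≤n)) 3≤m)
    i₂ = fromℕ< 3≤m
    α≉0 : ¬ (a i₁ - a i₀ ≈ 0#)
    α≉0 e with () ← fromℕ<-injective 1 0 _ _ (a-injective i₁ i₀ (x∙y⁻¹≈ε⇒x≈y _ _ e))
    β≉0 : ¬ (a i₂ - a i₀ ≈ 0#)
    β≉0 e with () ← fromℕ<-injective 2 0 _ _ (a-injective i₂ i₀ (x∙y⁻¹≈ε⇒x≈y _ _ e))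
    α≉β : ¬ (a i₁ - a i₀ ≈ a i₂ - a i₀)
    α≉β e with () ← fromℕ<-injective 1 2 _ _ (a-injective i₁ i₂ (∙-cancelʳ (- a i₀) _ _ e))

  module BlockCode {r n k q : ℕ} (α β : Carrier) (α≉0 : ¬ (α ≈ 0#)) (β≉0 : ¬ (β ≈ 0#)) (α≉β : ¬ (α ≈ β))
                   (P : Blocks.Partition k r q)
                   (leader : Fin (suc k) → Fin r) (block-leader : ∀ t → Blocks.Partition.block P (leader t) ≡ t) where
    open Blocks k using (blockSize)
    open Blocks.Partition P

    open Code {r} {n} α β α≉0 β≉0 α≉β (λ p → leader (block p)) (λ p → cong leader (block-leader (block p))) public

    indicator : Fin (suc k) → Matrix r (suc n)
    indicator t p j = δ (block p) t

    indicator∈C : ∀ t → InC A B (indicator t)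
    indicator∈C t = codeword-intro (indicator t)
      (λ p j → reflexive (cong (λ u → δ u t) (≡.sym (block-leader (block p)))))

    dimension : HasDimension A B (suc k)
    dimension = indicator , indicator∈C , independent , spanning
      where
      -- the coefficient of block t is read off at the leader of t
      independent : ∀ (cs : Fin (suc k) → Carrier) → lincomb cs indicator ≈ₘ 0ₘ → ∀ t → cs t ≈ 0#
      independent cs e t = subst (λ u → cs u ≈ 0#) (block-leader t)
        (trans (sym (sift′ (block (leader t)) cs)) (e (leader t) zero))
      spanning : ∀ X → InC A B X → ∃ λ (cs : Fin (suc k) → Carrier) → X ≈ₘ lincomb cs indicator
      spanning X X∈C = (λ t → X (leader t) zero) ,
        λ p j → trans (codeword-shape X X∈C p j) (sym (sift′ (block p) (λ t → X (leader t) zero)))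

    indicator-nonzero : ∀ t → ¬ (indicator t ≈ₘ 0ₘ)
    indicator-nonzero t ind≈0 = 0≉1 (sym (trans (sym (δ-diag t))
      (subst (λ u → δ u t ≈ 0#) (block-leader t) (ind≈0 (leader t) zero))))

    indicator-weight : ∀ t → HasWeight (indicator t) (blockSize block t * suc n)
    indicator-weight t = (λ p j → does (block p ≟ t)) , (λ p j → δ-support (block p) t) ,
      countTrue₂-rows (λ p → does (block p ≟ t))

    -- A codeword that is nonzero at the leader of block t is nonzero on the
    -- whole block, so its weight is at least |block t|·s.
    weight-bound : ∀ X → InC A B X → ∀ t → ¬ (X (leader t) zero ≈ 0#) →
      ∀ w → HasWeight X w → blockSize block t * suc n ≤ w
    weight-bound X X∈C t X≉0 w (S , S⇔X≉0 , |S|≡w) =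
      subst (_ ≤_) |S|≡w (subst (_≤ countTrue₂ S) (countTrue₂-rows (λ p → does (block p ≟ t)))
        (countTrue₂-mono (λ p j → does (block p ≟ t)) S in-support))
      where
      in-support : ∀ p j → does (block p ≟ t) ≡ true → S p j ≡ true
      in-support p j p∈t = Equivalence.from (S⇔X≉0 p j) (λ X≈0 → X≉0 (trans
        (sym (subst (λ u → X p j ≈ X (leader u) zero) (does-sound _ _ p∈t) (codeword-shape X X∈C p j))) X≈0))

    minimum-distance : HasMinDistance A B (q * suc n)
    minimum-distance =
      (indicator smallest , indicator∈C smallest , indicator-nonzero smallest ,
       subst (λ m → HasWeight (indicator smallest) (m * suc n)) smallest-size (indicator-weight smallest)) ,
      lower-bound
      where
      -- If the bound failed, every leader value would be (doubly negated) zero,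
      -- making X zero; since ≤ is decidable this contradiction suffices.
      lower-bound : ∀ X → InC A B X → ¬ (X ≈ₘ 0ₘ) → ∀ w → HasWeight X w → q * suc n ≤ w
      lower-bound X X∈C X≉0 w wt = decidable-stable (q * suc n ≤? w) λ bound-fails →
        ¬¬-∀-Fin (λ t leader≉0 → bound-fails
                   (ℕ.≤-trans (ℕ.*-monoˡ-≤ (suc n) (large t)) (weight-bound X X∈C t leader≉0 w wt)))
                 (λ leaders≈0 → X≉0 (λ p j → trans (codeword-shape X X∈C p j) (leaders≈0 (block p))))

theorem4p3 : ∀ {c ℓ : Level} (F : Field c ℓ) (r s k : ℕ) (1≤k : 1 ≤ k) → k ≤ r → k ≤ s →
    HasAtLeast F (k + 2) →
    let open FieldMatrices F in
    ∃₂ λ (A : Matrix r r) (B : Matrix s s) →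
    HasDimension A B k × HasMinDistance A B ((_/_ r k {{>-nonZero 1≤k}}) * s)
theorem4p3 F r (suc n) (suc k) 1≤k k≤r k≤s |F|≥k+2 with Construction.scalars F |F|≥k+2 (ℕ.+-monoˡ-≤ 2 1≤k)
... | α , β , α≉0 , β≉0 , α≉β = A , B , dimension , minimum-distance
  where
  open Blocks k using (balanced; representatives)
  partition = balanced r
  leaders = representatives partition (m≥n⇒m/n>0 k≤r)
  open Construction.BlockCode F {n = n} α β α≉0 β≉0 α≉β partition (proj₁ leaders) (proj₂ leaders)
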